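{- Let $(\mathrm{Spec},\chi,\le)$ be a specification theory for $\mathrm{Proc}$. (1) For all $\mathcal S_1,\mathcal S_2\in\mathrm{Spec}$, $\mathcal S_1\le\mathcal S_2$ implies $\mathcal S_1\preceq\mathcal S_2$, and $\mathcal S_1\equiv\mathcal S_2$ implies $\mathcal S_1\approxeq\mathcal S_2$. (2) For all $\mathcal I_1,\mathcal I_2\in\mathrm{Proc}$, the following are equivalent: $\chi(\mathcal I_1)\le\chi(\mathcal I_2)$, $\chi(\mathcal I_2)\le\chi(\mathcal I_1)$, $\chi(\mathcal I_1)\preceq\chi(\mathcal I_2)$, $\chi(\mathcal I_2)\preceq\chi(\mathcal I_1)$, $\mathcal I_1\boxminus\mathcal I_2$.
   Context: Let $\mathrm{Proc}$ be a set of models and $(\mathrm{Spec},\models)$ a specification formalism with $\models\subseteq\mathrm{Proc}\times\mathrm{Spec}$. Let $\mathrm{Mod}(\mathcal S)=\{\mathcal I\mid\mathcal I\models\mathcal S\}$ and $\mathrm{Th}(\mathcal I)=\{\mathcal S\mid\mathcal I\models\mathcal S\}$. Semantic refinement: $\mathcal S_1\preceq\mathcal S_2$ iff $\mathrm{Mod}(\mathcal S_1)\subseteq\mathrm{Mod}(\mathcal S_2)$, and $\approxeq=\preceq\cap\succeq$. On models, $\mathcal I_1\boxminus\mathcal I_2$ iff $\mathrm{Th}(\mathcal I_1)=\mathrm{Th}(\mathcal I_2)$. A characteristic formula for $\mathcal I$ is $\mathcal S$ with $\mathcal I\models\mathcal S$ and $\mathcal I'\boxminus\mathcal I$ for all $\mathcal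 I'\models\mathcal S$. A specification theory is such a formalism together with a map $\chi:\mathrm{Proc}\to\mathrm{Spec}$ and a preorder $\le$ on $\mathrm{Spec}$ such that $\chi(\mathcal I)$ is a characteristic formula for each $\mathcal I$, and $\mathcal I\models\mathcal S$ iff $\chi(\mathcal I)\le\mathcal S$. Modal equivalence is $\equiv=\le\cap\ge$. -}

module Defs where

open import Level using (Level; _⊔_; suc)
open import Data.Product using (_×_)
open import Relation.Binary.Core using (Rel)
open import Relation.Binary.Structures using (IsPreorder)
open import Relation.Binary.PropositionalEquality using (_≡_)

module Formalism {p s r : Level} (Proc : Set p) (Spec : Set s)
                 (_⊨_ : Proc → Spec → Set r) where

  Mod : Spec → Proc → Set r
  Mod S I = I ⊨ S

  Th : Proc → Spec → Set r
  Th I S = I ⊨ S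

  _≼_ : Spec → Spec → Set (p ⊔ r)
  S₁ ≼ S₂ = ∀ I → Mod S₁ I → Mod S₂ I

  _≊_ : Spec → Spec → Set (p ⊔ r)
  S₁ ≊ S₂ = (S₁ ≼ S₂) × (S₂ ≼ S₁)

  _⊟_ : Proc → Proc → Set (s ⊔ r)
  I₁ ⊟ I₂ = (∀ S → Th I₁ S → Th I₂ S) × (∀ S → Th I₂ S → Th I₁ S)

  IsCharacteristic : Spec → Proc → Set (p ⊔ s ⊔ r)
  IsCharacteristic S I = (I ⊨ S) × (∀ I′ → I′ ⊨ S → I′ ⊟ I)

  record SpecTheory (ℓ : Level) : Set (p ⊔ s ⊔ r ⊔ suc ℓ) where
    field
      χ        : Proc → Spec
      _≤_      : Rel Spec ℓ
      ≤-pre    : IsPreorder _≡_ _≤_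
      χ-char   : ∀ I → IsCharacteristic (χ I) I
      ⊨⇔χ≤    : ∀ I S → ((I ⊨ S → χ I ≤ S) × (χ I ≤ S → I ⊨ S))

    _≡ₘ_ : Rel Spec ℓ
    S₁ ≡ₘ S₂ = (S₁ ≤ S₂) × (S₂ ≤ S₁)

module Submission where

-- Since I ⊨ S iff χ I ≤ S, every model of S₁ ≤ S₂ is a model of S₂, and χ I ≼ S
-- likewise reduces to I ⊨ S.  Both χ I₁ ≤ χ I₂ and χ I₁ ≼ χ I₂ thus say I₁ ⊨ χ I₂,
-- which by the characteristic property of χ I₂ is I₁ ⊟ I₂; symmetry of ⊟ gives the
-- two remaining equivalences.

open import Defs
open import Level using (Level)
open import Data.Product using (_×_; _,_; proj₁; proj₂; swap)
open import Function.Bundles using (_⇔_; mk⇔; Equivalence)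
open import Function.Properties.Equivalence using () renaming (trans to ⇔-trans; sym to ⇔-sym)
open import Relation.Binary.Structures using (IsPreorder)

module SpecTheoryProperties {p s r ℓ : Level} {Proc : Set p} {Spec : Set s}
       {_⊨_ : Proc → Spec → Set r} (T : Formalism.SpecTheory Proc Spec _⊨_ ℓ) where

  open Formalism Proc Spec _⊨_
  open SpecTheory T

  ⊨⇔χ-≤ : ∀ {I S} → (I ⊨ S) ⇔ (χ I ≤ S)
  ⊨⇔χ-≤ {I} {S} = mk⇔ (proj₁ (⊨⇔χ≤ I S)) (proj₂ (⊨⇔χ≤ I S))

  ⊨-χ : ∀ I → I ⊨ χ I
  ⊨-χ I = proj₁ (χ-char I)

  ⊟-sym : ∀ {I₁ I₂} → I₁ ⊟ I₂ → I₂ ⊟ I₁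
  ⊟-sym = swap

  ≤⇒≼ : ∀ S₁ S₂ → S₁ ≤ S₂ → S₁ ≼ S₂
  ≤⇒≼ S₁ S₂ S₁≤S₂ I I⊨S₁ =
    Equivalence.from ⊨⇔χ-≤ (IsPreorder.trans ≤-pre (Equivalence.to ⊨⇔χ-≤ I⊨S₁) S₁≤S₂)

  ≡ₘ⇒≊ : ∀ S₁ S₂ → S₁ ≡ₘ S₂ → S₁ ≊ S₂
  ≡ₘ⇒≊ S₁ S₂ (S₁≤S₂ , S₂≤S₁) = ≤⇒≼ S₁ S₂ S₁≤S₂ , ≤⇒≼ S₂ S₁ S₂≤S₁

  ⊨⇔χ-≼ : ∀ {I S} → (I ⊨ S) ⇔ (χ I ≼ S)
  ⊨⇔χ-≼ {I} {S} = mk⇔ (λ I⊨S → ≤⇒≼ (χ I) S (Equivalence.to ⊨⇔χ-≤ I⊨S))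
                      (λ χI≼S → χI≼S I (⊨-χ I))

  ⊨-χ⇔⊟ : ∀ {I₁ I₂} → (I₁ ⊨ χ I₂) ⇔ (I₁ ⊟ I₂)
  ⊨-χ⇔⊟ {I₁} {I₂} = mk⇔ (proj₂ (χ-char I₂) I₁) (λ I₁⊟I₂ → proj₂ I₁⊟I₂ (χ I₂) (⊨-χ I₂))

  ⊟⇔⊟ᵒ : ∀ {I₁ I₂} → (I₁ ⊟ I₂) ⇔ (I₂ ⊟ I₁)
  ⊟⇔⊟ᵒ = mk⇔ ⊟-sym ⊟-sym

  χ-≤⇔⊟ : ∀ {I₁ I₂} → (χ I₁ ≤ χ I₂) ⇔ (I₁ ⊟ I₂)
  χ-≤⇔⊟ = ⇔-trans (⇔-sym ⊨⇔χ-≤) ⊨-χ⇔⊟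

  χ-≼⇔⊟ : ∀ {I₁ I₂} → (χ I₁ ≼ χ I₂) ⇔ (I₁ ⊟ I₂)
  χ-≼⇔⊟ = ⇔-trans (⇔-sym ⊨⇔χ-≼) ⊨-χ⇔⊟

proposition2 : {p s r ℓ : Level} (Proc : Set p) (Spec : Set s)
    (_⊨_ : Proc → Spec → Set r) →
    let open Formalism Proc Spec _⊨_ in
    (T : SpecTheory ℓ) →
    let open SpecTheory T in
    ((∀ S₁ S₂ → S₁ ≤ S₂ → S₁ ≼ S₂) × (∀ S₁ S₂ → S₁ ≡ₘ S₂ → S₁ ≊ S₂))
    × (∀ I₁ I₂ →
         ((χ I₁ ≤ χ I₂) ⇔ (I₁ ⊟ I₂))
         × ((χ I₂ ≤ χ I₁) ⇔ (I₁ ⊟ I₂))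
         × ((χ I₁ ≼ χ I₂) ⇔ (I₁ ⊟ I₂))
         × ((χ I₂ ≼ χ I₁) ⇔ (I₁ ⊟ I₂)))
proposition2 Proc Spec _⊨_ T =
  (≤⇒≼ , ≡ₘ⇒≊) ,
  λ I₁ I₂ → χ-≤⇔⊟ , ⇔-trans χ-≤⇔⊟ ⊟⇔⊟ᵒ , χ-≼⇔⊟ , ⇔-trans χ-≼⇔⊟ ⊟⇔⊟ᵒ
  where open SpecTheoryProperties T
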